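{- Let $G=(V,E)$ be a graph and $k\ge 1$. Let $\mathcal{P}$ be a maximal collection of vertex triples contained in $V_{\mathrm{ld}}$, each inducing a $P_3$, such that any two distinct triples in $\mathcal{P}$ share at most one vertex. Let $V_{\mathrm{ldmod}}:=V_{\mathrm{ld}}\setminus\bigcup_{P\in\mathcal{P}}P$. Then every connected component of the subgraph induced by $V_{\mathrm{ldmod}}$ is an extended clique-module in the subgraph of $G$ induced by $V_{\mathrm{ld}}$.
   Context: Graphs are undirected, without self-loops, possibly with multi-edges. $N(v)$ is the neighbor set; $\rho(v)$ is the number of unordered pairs of neighbors of $v$ that are adjacent (parallel edges counted once). $V_{\mathrm{ld}}$ is the set of vertices $v$ with $|N(v)|>7k$ and $\rho(v)>|N(v)|(|N(v)|-1)/4$. A triple $(v_1,v_2,v_3)$ of distinct vertices induces a $P_3$ if $v_1v_2, v_2v_3\in E$ and $v_1v_3\notin E$ (edges may be multi-edges). A vertex set $Z$ is an extended clique-module in a graph $G'$ if (i) every two distinct $u,v\in Z$ are adjacent in $G'$, and (ii) $N_{G'}(u)\cup\{u\}=N_{G'}(v)\cup\{v\}$ for all $u,v\in Z$. -}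

module Defs where

open import Data.Nat using (ℕ; zero; suc; _+_; _*_; _∸_; _≤_; _<_)
open import Data.Bool using (Bool; true; false; _∧_; _∨_; if_then_else_)
open import Data.Fin using (Fin; toℕ) renaming (zero to fz; suc to fs)
import Data.Fin as F
open import Data.Nat using (_<ᵇ_)
open import Data.List using (List)
open import Data.List.Membership.Propositional using (_∈_)
open import Data.Product using (Σ; _×_; ∃)
open import Data.Sum using (_⊎_)
open import Relation.Nullary using (¬_; Dec; yes; no)
open import Relation.Nullary.Decidable using (⌊_⌋)
open import Relation.Binary.PropositionalEquality using (_≡_; _≢_)
open import Function.Bundles using (_⇔_)

-- Only adjacency matters for every notion
-- in the statement (N(v), ρ(v), P3, cliques, modules), so multi-edges are
-- represented by their underlying adjacency relation.
record Graph : Set where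
  field
    n      : ℕ
    adj    : Fin n → Fin n → Bool
    sym    : ∀ u v → adj u v ≡ adj v u
    irrefl : ∀ v → adj v v ≡ false

sumF : ∀ {m} → (Fin m → ℕ) → ℕ
sumF {zero}  f = 0
sumF {suc m} f = f fz + sumF (λ i → f (fs i))

countF : ∀ {m} → (Fin m → Bool) → ℕ
countF p = sumF (λ i → if p i then 1 else 0)

module _ (G : Graph) where
  open Graph G

  Adj : Fin n → Fin n → Set
  Adj u v = adj u v ≡ true

  deg : Fin n → ℕ
  deg v = countF (adj v)

  ρ : Fin n → ℕ
  ρ v = sumF (λ u → countF (λ w →
          (toℕ u <ᵇ toℕ w) ∧ adj v u ∧ adj v w ∧ adj u w))

  -- v ∈ V_ld :  |N(v)| > 7k  and  ρ(v) > |N(v)|(|N(v)|-1)/4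
  InVld : ℕ → Fin n → Set
  InVld k v = (7 * k < deg v) × (deg v * (deg v ∸ 1) < 4 * ρ v)

  record Triple : Set where
    constructor ⟨_,_,_⟩
    field
      t₁ t₂ t₃ : Fin n

  _∈T_ : Fin n → Triple → Set
  x ∈T ⟨ a , b , c ⟩ = x ≡ a ⊎ x ≡ b ⊎ x ≡ c

  memᵇ : Fin n → Triple → Bool
  memᵇ x ⟨ a , b , c ⟩ = ⌊ x F.≟ a ⌋ ∨ ⌊ x F.≟ b ⌋ ∨ ⌊ x F.≟ c ⌋

  SameSet : Triple → Triple → Set
  SameSet P Q = ∀ x → (x ∈T P) ⇔ (x ∈T Q)

  shared : Triple → Triple → ℕ
  shared P Q = countF (λ x → memᵇ x P ∧ memᵇ x Q)

  InducesP3 : Triple → Set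
  InducesP3 ⟨ a , b , c ⟩ =
    a ≢ b × b ≢ c × a ≢ c × Adj a b × Adj b c × ¬ Adj a c

  ValidTriple : ℕ → Triple → Set
  ValidTriple k T = InducesP3 T × (∀ x → x ∈T T → InVld k x)

  Packing : List Triple → Set
  Packing 𝒫 = ∀ P Q → P ∈ 𝒫 → Q ∈ 𝒫 → ¬ SameSet P Q → shared P Q ≤ 1

  -- 𝒫 is a maximal collection of valid triples with the packing property:
  -- every valid triple not already in 𝒫 shares ≥ 2 vertices with some member
  -- (i.e. adding it would violate the packing property)
  MaximalP3Packing : ℕ → List Triple → Set
  MaximalP3Packing k 𝒫 =
    (∀ P → P ∈ 𝒫 → ValidTriple k P) ×
    Packing 𝒫 ×
    (∀ T → ValidTriple k T → (∀ P → P ∈ 𝒫 → ¬ SameSet T P) →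
       Σ Triple λ P → P ∈ 𝒫 × 2 ≤ shared T P)

  InVldmod : ℕ → List Triple → Fin n → Set
  InVldmod k 𝒫 x = InVld k x × (∀ P → P ∈ 𝒫 → ¬ (x ∈T P))

  data Reach (S : Fin n → Set) : Fin n → Fin n → Set where
    here : ∀ {u} → S u → Reach S u u
    step : ∀ {u w v} → S u → Adj u w → Reach S w v → Reach S u v

  IsComponent : (S : Fin n → Set) → (Fin n → Set) → Set
  IsComponent S Z =
    (∃ λ z → Z z) ×
    (∀ z → Z z → S z) ×
    (∀ u v → Z u → Z v → Reach S u v) ×
    (∀ u v → Z u → Reach S u v → Z v)

  ClosedNbhd : (S : Fin n → Set) → Fin n → Fin n → Set
  ClosedNbhd S u w = (S w × Adj u w) ⊎ w ≡ u

  ExtendedCliqueModule : (S : Fin n → Set) → (Fin n → Set) → Set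
  ExtendedCliqueModule S Z =
    (∀ u v → Z u → Z v → u ≢ v → Adj u v) ×
    (∀ u v → Z u → Z v → ∀ w → ClosedNbhd S u w ⇔ ClosedNbhd S v w)

{-# OPTIONS --safe #-}
-- Maximality of 𝒫 means that every P3 inside V_ld either belongs to 𝒫 or
-- meets some member of 𝒫 in two vertices; either way at most one of its
-- vertices lies in V_ldmod.  Hence if u, v ∈ V_ldmod are adjacent and w is a
-- neighbour of u in V_ld other than v, then w is adjacent to v, for otherwise
-- (w, u, v) would be a P3 with two vertices in V_ldmod.  So adjacent vertices
-- of V_ldmod have the same closed neighbourhood in G[V_ld], and this equality
-- propagates along paths in G[V_ldmod] to whole components; two vertices with
-- the same closed neighbourhood are adjacent.
module Submission where

open import Defs
open import Data.Nat using (ℕ; _≤_; z≤n; s≤s; zero; suc)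
open import Data.Nat.Properties using (≤-reflexive; ≤-trans)
open import Data.Fin using (Fin) renaming (zero to fz; suc to fs)
import Data.Fin as F
open import Data.Fin.Properties using (suc-injective)
open import Data.List using (List)
open import Data.List.Membership.Propositional using (_∈_)
open import Data.Bool using (Bool; true; false)
import Data.Bool as B
open import Data.Product using (_,_; proj₂)
open import Data.Sum using (inj₁; inj₂)
open import Data.Empty using (⊥; ⊥-elim)
open import Relation.Nullary using (¬_; yes; no)
open import Relation.Binary.PropositionalEquality
  using (_≡_; _≢_; refl; sym; trans)
open import Function.Bundles using (_⇔_; mk⇔; Equivalence)
open import Function.Construct.Identity using (⇔-id)
open import Function.Construct.Composition using (_⇔-∘_)

countF-false : ∀ {m} (p : Fin m → Bool) → (∀ x → p x ≡ false) → countF p ≡ 0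
countF-false {zero}  p all-false = refl
countF-false {suc m} p all-false rewrite all-false fz =
  countF-false (λ i → p (fs i)) (λ i → all-false (fs i))

countF-≤1 : ∀ {m} (p : Fin m → Bool) →
            (∀ x y → p x ≡ true → p y ≡ true → x ≡ y) → countF p ≤ 1
countF-≤1 {zero}  p unique = z≤n
countF-≤1 {suc m} p unique with p fz in p₀
... | true  = s≤s (≤-reflexive (countF-false (λ i → p (fs i)) tail-false))
  where
  tail-false : ∀ i → p (fs i) ≡ false
  tail-false i with p (fs i) in pᵢ
  ... | false = refl
  ... | true with unique fz (fs i) p₀ pᵢ
  ...   | ()
... | false = countF-≤1 (λ i → p (fs i))
                (λ x y px py → suc-injective (unique (fs x) (fs y) px py))

module _ (G : Graph) where
  open Graph G using (n; adj; irrefl)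

  Adj-sym : ∀ {u v} → Adj G u v → Adj G v u
  Adj-sym {u} {v} uv = trans (Graph.sym G v u) uv

  Adj⇒≢ : ∀ {u v} → Adj G u v → u ≢ v
  Adj⇒≢ {u} uu refl with trans (sym uu) (irrefl u)
  ... | ()

  memᵇ-sound : ∀ x P → memᵇ G x P ≡ true → _∈T_ G x P
  memᵇ-sound x ⟨ a , b , c ⟩ x∈ with x F.≟ a | x F.≟ b | x F.≟ c
  ... | yes x≡a | _       | _       = inj₁ x≡a
  ... | no _    | yes x≡b | _       = inj₂ (inj₁ x≡b)
  ... | no _    | no _    | yes x≡c = inj₂ (inj₂ x≡c)
  ... | no _    | no _    | no _    with x∈
  ...   | ()

  shared-≤1 : ∀ {w u v} P → ¬ _∈T_ G u P → ¬ _∈T_ G v P →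
              shared G ⟨ w , u , v ⟩ P ≤ 1
  shared-≤1 {w} {u} {v} P u∉P v∉P = countF-≤1 _ λ x y x∈ y∈ →
    trans (only-w x x∈) (sym (only-w y y∈))
    where
    only-w : ∀ x → (memᵇ G x ⟨ w , u , v ⟩ B.∧ memᵇ G x P) ≡ true → x ≡ w
    only-w x both with memᵇ G x ⟨ w , u , v ⟩ in x∈T | memᵇ G x P in x∈P
    ... | true | true with memᵇ-sound x _ x∈T | memᵇ-sound x P x∈P
    ...   | inj₁ x≡w         | _   = x≡w
    ...   | inj₂ (inj₁ refl) | u∈P = ⊥-elim (u∉P u∈P)
    ...   | inj₂ (inj₂ refl) | v∈P = ⊥-elim (v∉P v∈P)

  SameClosedNbhd : (S : Fin n → Set) → Fin n → Fin n → Set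
  SameClosedNbhd S u v = ∀ w → ClosedNbhd G S u w ⇔ ClosedNbhd G S v w

  SameClosedNbhd⇒Adj : ∀ {S u v} → SameClosedNbhd S u v → u ≢ v → Adj G u v
  SameClosedNbhd⇒Adj {v = v} same u≢v with Equivalence.from (same v) (inj₂ refl)
  ... | inj₁ (_ , uv) = uv
  ... | inj₂ v≡u      = ⊥-elim (u≢v (sym v≡u))

  Reach-source : ∀ {S u v} → Reach G S u v → S u
  Reach-source (here Su)     = Su
  Reach-source (step Su _ _) = Su

  Reach⇒ : ∀ {S} (R : Fin n → Fin n → Set) →
           (∀ {u} → R u u) → (∀ {u w v} → R u w → R w v → R u v) →
           (∀ {u w} → S u → S w → Adj G u w → R u w) →
           ∀ {u v} → Reach G S u v → R u v
  Reach⇒ R R-refl R-trans edge (here _)        = R-refl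
  Reach⇒ R R-refl R-trans edge (step Su uw wv) =
    R-trans (edge Su (Reach-source wv) uw) (Reach⇒ R R-refl R-trans edge wv)

  module _ (k : ℕ) (𝒫 : List (Triple G)) (maximal : MaximalP3Packing G k 𝒫) where

    Uncovered : Fin n → Set
    Uncovered x = ∀ P → P ∈ 𝒫 → ¬ _∈T_ G x P

    uncovered-t₂⇒∉𝒫 : ∀ {w u v} → Uncovered u →
                      ∀ P → P ∈ 𝒫 → ¬ SameSet G ⟨ w , u , v ⟩ P
    uncovered-t₂⇒∉𝒫 {u = u} u-unc P P∈𝒫 same =
      u-unc P P∈𝒫 (Equivalence.to (same u) (inj₂ (inj₁ refl)))

    ¬valid-triple-with-uncovered-t₂-t₃ :
      ∀ {w u v} → ValidTriple G k ⟨ w , u , v ⟩ → Uncovered u → Uncovered v → ⊥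
    ¬valid-triple-with-uncovered-t₂-t₃ valid u-unc v-unc
      with proj₂ (proj₂ maximal) _ valid (uncovered-t₂⇒∉𝒫 u-unc)
    ... | P , P∈𝒫 , 2≤shared
      with ≤-trans 2≤shared (shared-≤1 P (u-unc P P∈𝒫) (v-unc P P∈𝒫))
    ...   | s≤s ()

    Vldmod-edge⇒closedNbhd-⊆ :
      ∀ {u v} → InVldmod G k 𝒫 u → InVldmod G k 𝒫 v → Adj G u v →
      ∀ w → ClosedNbhd G (InVld G k) u w → ClosedNbhd G (InVld G k) v w
    Vldmod-edge⇒closedNbhd-⊆ (ld-u , _) _ uv _ (inj₂ refl) =
      inj₁ (ld-u , Adj-sym uv)
    Vldmod-edge⇒closedNbhd-⊆ {u} {v} (ld-u , u-unc) (ld-v , v-unc) uv w (inj₁ (ld-w , uw))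
      with w F.≟ v | adj v w B.≟ true
    ... | yes w≡v | _       = inj₂ w≡v
    ... | no _    | yes vw  = inj₁ (ld-w , vw)
    ... | no w≢v  | no ¬vw  =
      ⊥-elim (¬valid-triple-with-uncovered-t₂-t₃ valid u-unc v-unc)
      where
      valid : ValidTriple G k ⟨ w , u , v ⟩
      valid = ( (λ w≡u → Adj⇒≢ uw (sym w≡u)) , Adj⇒≢ uv , w≢v
              , Adj-sym uw , uv , (λ wv → ¬vw (Adj-sym wv)) )
            , λ { _ (inj₁ refl)        → ld-w
                ; _ (inj₂ (inj₁ refl)) → ld-u
                ; _ (inj₂ (inj₂ refl)) → ld-v }

    Reach⇒SameClosedNbhd : ∀ {u v} → Reach G (InVldmod G k 𝒫) u v →
                           SameClosedNbhd (InVld G k) u v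
    Reach⇒SameClosedNbhd = Reach⇒ (SameClosedNbhd (InVld G k))
      (λ _ → ⇔-id _) (λ uw wv x → wv x ⇔-∘ uw x)
      (λ u-mod w-mod uw x → mk⇔ (Vldmod-edge⇒closedNbhd-⊆ u-mod w-mod uw x)
                                (Vldmod-edge⇒closedNbhd-⊆ w-mod u-mod (Adj-sym uw) x))

lemma19 : (G : Graph) (k : ℕ) → 1 ≤ k →
    (𝒫 : List (Triple G)) → MaximalP3Packing G k 𝒫 →
    (Z : Fin (Graph.n G) → Set) → IsComponent G (InVldmod G k 𝒫) Z →
    ExtendedCliqueModule G (InVld G k) Z
lemma19 G k _ 𝒫 maximal Z (_ , _ , connected , _) =
  (λ u v Zu Zv → SameClosedNbhd⇒Adj G (same u v Zu Zv)) , same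
  where
  same : ∀ u v → Z u → Z v → SameClosedNbhd G (InVld G k) u v
  same u v Zu Zv = Reach⇒SameClosedNbhd G k 𝒫 maximal (connected u v Zu Zv)
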